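{- The following problem is undecidable: given $n \ge 0$ and a program $P \in \mathit{MM}^n$, decide whether $P \to^* \mathtt{return}\;\mathtt{true}$. Here, for variables $x_0,x_1,f_0,\dots,f_n$ and an operation name $\mathit{succ}$, $\mathit{Inst}^n$ is the set consisting of $()$ (i.e.\ $\mathtt{return}\;()$), all computations $c_{inc}^{i,j} = \mathtt{let}\;x_i = \mathtt{return}\;(\lambda y.\mathit{succ}\;x_i)\;\mathtt{in}\;f_j\,x_0\,x_1$ for $i\in\{0,1\}$, $j\in\{0,\dots,n\}$, and all computations $c_{dec}^{i,j,m} = \mathtt{with}\;\{\mathtt{return}\;x = f_j\,x_0\,x_1,\ \mathit{succ}\;x_i\;k = f_m\,x_0\,x_1\}\;\mathtt{handle}\;x_i\,()$ for $i\in\{0,1\}$, $j,m\in\{0,\dots,n\}$; and $\mathit{MM}^n$ is the set of programs $\mathtt{mrec}\;f_0 = \lambda x_0.\lambda x_1.c_0\;\mathtt{and}\;\cdots\;\mathtt{and}\;f_n = \lambda x_0.\lambda x_1.c_n\;\mathtt{in}\;(f_0\,(\lambda x.())\,(\lambda x.()));\mathtt{return}\;\mathtt{true}$ with each $c_i \in \mathit{Inst}^n$.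
   Context: Syntax. Values $v ::= x \mid () \mid \mathtt{true} \mid \mathtt{false} \mid \lambda x.c \mid \mathtt{rec}\;x = v$; computations $c ::= \mathtt{return}\;v \mid \mathit{op}\;v \mid v_1\,v_2 \mid \mathtt{if}\;v\;\mathtt{then}\;c_1\;\mathtt{else}\;c_2 \mid \mathtt{let}\;x = c_1\;\mathtt{in}\;c_2 \mid \mathtt{with}\;h\;\mathtt{handle}\;c$; handlers $h ::= \{\mathtt{return}\;x = c,\ \mathit{op}_1\,x_1\,k_1 = c_1, \dots\}$; $\mathtt{rec}\;x=v$ binds $x$ in $v$; in an operation clause $\mathit{op}\;x\;k = c$, $x$ and $k$ are bound in $c$. A program is a closed computation. Notational conventions: a value written where a computation is expected stands for $\mathtt{return}$ of it; $f_j\,x_0\,x_1$ stands for $\mathtt{let}\;w = f_j\,x_0\;\mathtt{in}\;w\,x_1$ ($w$ fresh); $c_1;c_2$ stands for $\mathtt{let}\;z=c_1\;\mathtt{in}\;c_2$ with $z$ not free in $c_2$; $f_0\,(\lambda x.())\,(\lambda x.())$ is similarly desugared. The mutual recursion $\mathtt{mrec}\;f_0=v_0\;\mathtt{and}\dots\mathtt{and}\;f_n=v_n\;\mathtt{in}\;c$ is defined inductively as $\mathtt{let}\;f_0 = \mathtt{return}\,(\mathtt{rec}\;f_0 = (\mathtt{mrec}\;f_1=v_1\;\mathtt{and}\dots\mathtt{and}\;f_n=v_n\;\mathtt{in}\;v_0))\;\mathtt{in}\;\cdots\;\mathtt{let}\;f_n = \mathtt{return}\,(\mathtt{rec}\;f_n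 = (\mathtt{mrec}\;f_0=v_0\;\mathtt{and}\dots\mathtt{and}\;f_{n-1}=v_{n-1}\;\mathtt{in}\;v_n))\;\mathtt{in}\;c$ (with $\mathtt{mrec}$ with no definitions and body a value $v$ meaning $v$). Evaluation contexts: $E ::= [\,] \mid \mathtt{let}\;x = E\;\mathtt{in}\;c$. Semantics: $\to$ is the least relation such that: if $c_1\to c_2$ then $\mathtt{let}\;x=c_1\;\mathtt{in}\;c \to \mathtt{let}\;x=c_2\;\mathtt{in}\;c$; $\mathtt{let}\;x=\mathtt{return}\;v\;\mathtt{in}\;c \to c[v/x]$; $(\lambda x.c)\,v \to c[v/x]$; $(\mathtt{rec}\;x=v)\,v' \to v[(\mathtt{rec}\;x=v)/x]\,v'$; $\mathtt{if}\;\mathtt{true}\;\mathtt{then}\;c_1\;\mathtt{else}\;c_2 \to c_1$; $\mathtt{if}\;\mathtt{false}\;\mathtt{then}\;c_1\;\mathtt{else}\;c_2 \to c_2$; if $c\to c'$ then $\mathtt{with}\;h\;\mathtt{handle}\;c \to \mathtt{with}\;h\;\mathtt{handle}\;c'$; $\mathtt{with}\;h\;\mathtt{handle}\;\mathtt{return}\;v \to c[v/x]$ where $\mathtt{return}\;x=c$ is the return clause of $h$; $\mathtt{with}\;h\;\mathtt{handle}\;E[\mathit{op}\;v] \to c[v/x, (\lambda y.\mathtt{with}\;h\;\mathtt{handle}\;E[\mathtt{return}\;y])/k]$ where $\mathit{op}\;x\;k = c$ is a clause of $h$. $\to^*$ is the reflexive-transitive closure. -}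

module Defs where

open import Data.Nat using (ℕ; zero; suc; _≡ᵇ_)
open import Data.Bool using (Bool; true; false; if_then_else_)
open import Data.Fin using (Fin; toℕ)
open import Data.List using (List; []; _∷_; map; length; foldr; _++_)
open import Data.Product using (Σ; ∃; _×_; _,_)
open import Data.Maybe using (Maybe; just; nothing)
open import Relation.Binary.PropositionalEquality using (_≡_)
open import Relation.Binary.Construct.Closure.ReflexiveTransitive using (Star)

Var : Set
Var = ℕ

OpName : Set
OpName = ℕ

mutual
  data Val : Set where
    var   : Var → Val
    unit  : Val
    vtrue vfalse : Val
    lam   : Var → Comp → Val
    rec   : Var → Val → Val

  data Comp : Set where
    ret    : Val → Comp
    op     : OpName → Val → Comp
    app    : Val → Val → Comp
    ite    : Val → Comp → Comp → Comp
    let'   : Var → Comp → Comp → Comp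
    handle : Handler → Comp → Comp

  -- { return x = c , op₁ x₁ k₁ = c₁ , … }
  data Handler : Set where
    hd : Var → Comp → List OpClause → Handler

  -- op x k = c
  data OpClause : Set where
    cl : OpName → Var → Var → Comp → OpClause

-- Only ever used with closed u (programs are closed
-- and evaluation only substitutes closed values), so no capture avoidance
-- is needed; substitution stops at binders for the same name.

mutual
  substV : Var → Val → Val → Val
  substV x u (var y) = if x ≡ᵇ y then u else var y
  substV x u unit = unit
  substV x u vtrue = vtrue
  substV x u vfalse = vfalse
  substV x u (lam y c) = if x ≡ᵇ y then lam y c else lam y (substC x u c)
  substV x u (rec y v) = if x ≡ᵇ y then rec y v else rec y (substV x u v)

  substC : Var → Val → Comp → Comp
  substC x u (ret v) = ret (substV x u v)
  substC x u (op o v) = op o (substV x u v)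
  substC x u (app v w) = app (substV x u v) (substV x u w)
  substC x u (ite v c₁ c₂) = ite (substV x u v) (substC x u c₁) (substC x u c₂)
  substC x u (let' y c₁ c₂) =
    let' y (substC x u c₁) (if x ≡ᵇ y then c₂ else substC x u c₂)
  substC x u (handle h c) = handle (substH x u h) (substC x u c)

  substH : Var → Val → Handler → Handler
  substH x u (hd y c cls) = hd y (if x ≡ᵇ y then c else substC x u c) (substCls x u cls)

  substCls : Var → Val → List OpClause → List OpClause
  substCls x u [] = []
  substCls x u (cl o y k c ∷ cls) =
    cl o y k (if (x ≡ᵇ y) Data.Bool.∨ (x ≡ᵇ k) then c else substC x u c)
      ∷ substCls x u cls

data ECtx : Set where
  hole : ECtx
  letE : Var → ECtx → Comp → ECtx

plug : ECtx → Comp → Comp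
plug hole c = c
plug (letE x E c') c = let' x (plug E c) c'

lookupClause : OpName → List OpClause → Maybe (Var × Var × Comp)
lookupClause o [] = nothing
lookupClause o (cl o' x k c ∷ cls) =
  if o ≡ᵇ o' then just (x , k , c) else lookupClause o cls

-- bound name used for the λ y in the continuation (any name works,
-- since the plugged context is closed and does not bind under the hole)
contVar : Var
contVar = 3

infix 4 _⟶_ _⟶*_

data _⟶_ : Comp → Comp → Set where
  letS   : ∀ {x c₁ c₂ c} → c₁ ⟶ c₂ → let' x c₁ c ⟶ let' x c₂ c
  letR   : ∀ {x v c} → let' x (ret v) c ⟶ substC x v c
  appλ   : ∀ {x c v} → app (lam x c) v ⟶ substC x v c
  appRec : ∀ {x v v'} → app (rec x v) v' ⟶ app (substV x (rec x v) v) v'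
  ifT    : ∀ {c₁ c₂} → ite vtrue c₁ c₂ ⟶ c₁
  ifF    : ∀ {c₁ c₂} → ite vfalse c₁ c₂ ⟶ c₂
  hS     : ∀ {h c c'} → c ⟶ c' → handle h c ⟶ handle h c'
  hR     : ∀ {x cr cls v} → handle (hd x cr cls) (ret v) ⟶ substC x v cr
  hOp    : ∀ {xr cr cls E o v x k c} →
           lookupClause o cls ≡ just (x , k , c) →
           handle (hd xr cr cls) (plug E (op o v)) ⟶
             substC k (lam contVar (handle (hd xr cr cls) (plug E (ret (var contVar)))))
                      (substC x v c)

_⟶*_ : Comp → Comp → Set
_⟶*_ = Star _⟶_

picks : {A : Set} → List A → List (A × List A)
picks [] = []
picks (a ∷ as) = (a , as) ∷ map (λ { (b , bs) → (b , a ∷ bs) }) (picks as)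

substsV : List (Var × Val) → Val → Val
substsV [] v = v
substsV ((f , u) ∷ r) v = substsV r (substV f u v)

-- mrec D in v, for a value body v: the value that the let-chain
-- reduces to (fuel = number of definitions)
mrecValN : ℕ → List (Var × Val) → Val → Val
mrecValN zero D v = v
mrecValN (suc n) D v =
  substsV (map (λ { ((f , vf) , rest) → (f , rec f (mrecValN n rest vf)) }) (picks D)) v

mrecVal : List (Var × Val) → Val → Val
mrecVal D v = mrecValN (length D) D v

mrecC : List (Var × Val) → Comp → Comp
mrecC D c =
  foldr (λ { ((f , vf) , rest) acc → let' f (ret (rec f (mrecVal rest vf))) acc })
        c (picks D)

x₀ x₁ xV yV kV wV zV : Var
x₀ = 0
x₁ = 1
xV = 2
yV = 3
kV = 4
wV = 5
zV = 6

fV : {n : ℕ} → Fin n → Var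
fV j = 7 Data.Nat.+ toℕ j

succOp : OpName
succOp = 0

xI : Fin 2 → Var
xI i = toℕ i

app2 : Val → Val → Val → Comp
app2 f a b = let' wV (app f a) (app (var wV) b)

data Inst (n : ℕ) : Set where
  iUnit : Inst n
  iInc  : Fin 2 → Fin (suc n) → Inst n
  iDec  : Fin 2 → Fin (suc n) → Fin (suc n) → Inst n

⟦_⟧I : {n : ℕ} → Inst n → Comp
⟦ iUnit ⟧I = ret unit
⟦ iInc i j ⟧I =
  let' (xI i) (ret (lam yV (op succOp (var (xI i)))))
       (app2 (var (fV j)) (var x₀) (var x₁))
⟦ iDec i j m ⟧I =
  handle (hd xV (app2 (var (fV j)) (var x₀) (var x₁))
             (cl succOp (xI i) kV (app2 (var (fV m)) (var x₀) (var x₁)) ∷ []))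
         (app (var (xI i)) unit)

allFinL : (n : ℕ) → List (Fin n)
allFinL zero = []
allFinL (suc n) = Data.Fin.zero ∷ map Data.Fin.suc (allFinL n)

mmProgram : (n : ℕ) → (Fin (suc n) → Inst n) → Comp
mmProgram n cs =
  mrecC (map (λ j → (fV j , lam x₀ (ret (lam x₁ ⟦ cs j ⟧I)))) (allFinL (suc n)))
        (let' zV (app2 (var (fV {suc n} Data.Fin.zero)) (lam xV (ret unit)) (lam xV (ret unit)))
              (ret vtrue))

MMInstance : Set
MMInstance = Σ ℕ (λ n → Fin (suc n) → Inst n)

MMTrue : MMInstance → Set
MMTrue (n , cs) = mmProgram n cs ⟶* ret vtrue

data MInstr : Set where
  inc : Fin 2 → ℕ → MInstr
  dec : Fin 2 → ℕ → ℕ → MInstr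

MinskyMachine : Set
MinskyMachine = List MInstr

Config : Set
Config = ℕ × ℕ × ℕ   -- program counter, counter 0, counter 1

nth : List MInstr → ℕ → Maybe MInstr
nth [] _ = nothing
nth (a ∷ as) zero = just a
nth (a ∷ as) (suc k) = nth as k

getC : Fin 2 → ℕ → ℕ → ℕ
getC Data.Fin.zero a b = a
getC (Data.Fin.suc _) a b = b

setC : Fin 2 → ℕ → ℕ → ℕ → ℕ × ℕ
setC Data.Fin.zero v a b = v , b
setC (Data.Fin.suc _) v a b = a , v

data MStep (M : MinskyMachine) : Config → Config → Set where
  sInc  : ∀ {p a b i j} → nth M p ≡ just (inc i j) →
          MStep M (p , a , b) (j , setC i (suc (getC i a b)) a b)
  sDecZ : ∀ {p a b i j m} → nth M p ≡ just (dec i j m) → getC i a b ≡ 0 →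
          MStep M (p , a , b) (j , a , b)
  sDecS : ∀ {p a b i j m n} → nth M p ≡ just (dec i j m) → getC i a b ≡ suc n →
          MStep M (p , a , b) (m , setC i n a b)

Halts : MinskyMachine → Set
Halts M = ∃ λ (cfg : Config) →
  Star (MStep M) (0 , 0 , 0) cfg × (let (p , _ , _) = cfg in nth M p ≡ nothing)

-- A two-counter Minsky machine with N instructions is compiled to the program
-- of MMᴺ in which fₚ performs instruction p; counter value a is represented by
-- the numeral obtained from λx.() by wrapping it a times in λy.succ(·), and
-- every jump outside the machine goes to the halting body f_N = ().  Once the
-- mutual recursion is unfolded, each machine step is simulated by a nonempty
-- sequence of reductions between states  let z = fₚ ⌜a⌝ ⌜b⌝ in return true,
-- and a halted state reduces to return true.  Reduction is deterministic and
-- return true is a normal form, so a run of the program to return true passes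
-- through all simulated states: it exists iff the machine halts.
module Submission where

open import Defs
open import Data.Product using (Σ)
open import Function.Bundles using (_⇔_)

open import Data.Bool using (true; false; if_then_else_)
open import Data.Empty using (⊥-elim)
open import Data.Fin using (Fin; toℕ; zero; suc; fromℕ; fromℕ<)
open import Data.Fin.Properties using (_≟_; toℕ-injective; toℕ-fromℕ; toℕ-fromℕ<)
open import Data.List using (List; []; _∷_; map; allFin; length; foldr)
import Data.List.Properties as List
open import Data.List.Membership.Propositional using (_∈_)
open import Data.List.Membership.Propositional.Properties using (∈-allFin)
open import Data.List.Relation.Binary.Permutation.Propositional using (_↭_; ↭-refl; ↭-trans; ↭-prep; ↭-swap)
open import Data.List.Relation.Binary.Permutation.Propositional.Properties using (∈-resp-↭; ↭-length)
open import Data.List.Relation.Unary.All using (All; []; _∷_)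
import Data.List.Relation.Unary.All.Properties as All
open import Data.List.Relation.Unary.All.Properties using (All¬⇒¬Any)
open import Data.List.Relation.Unary.Any as Any using (here; there)
open import Data.List.Relation.Unary.Unique.Propositional using (Unique; []; _∷_)
open import Data.List.Relation.Unary.Unique.Propositional.Properties using (allFin⁺)
open import Data.Maybe using (Maybe; just; nothing)
open import Data.Nat using (ℕ; zero; suc; _≡ᵇ_; _≤_; s≤s; _<?_)
open import Data.Nat.Properties using (≡ᵇ⇒≡; ≡⇒≡ᵇ; +-cancelˡ-≡; suc-injective; ≤-refl; ≮⇒≥; m<n⇒m<1+n)
import Data.Product as Product
open import Data.Product using (∃; _×_; _,_; -,_; proj₁; proj₂)
open import Data.Sum as Sum using (_⊎_; inj₁; inj₂)
open import Data.Unit using (tt)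
open import Function using (id; _∘_)
open import Function.Bundles using (mk⇔)
open import Level using (0ℓ)
open import Relation.Binary.Core using (Rel)
open import Relation.Binary.Construct.Closure.ReflexiveTransitive using (Star; ε; _◅_; _◅◅_)
open import Relation.Binary.Construct.Closure.Transitive using (TransClosure; [_]; _∷_; _∷ʳ_; _++_)
open import Relation.Binary.PropositionalEquality
  using (_≡_; _≢_; refl; sym; trans; cong; cong₂; subst; module ≡-Reasoning)
open import Relation.Binary.Rewriting using (Deterministic; IsNormalForm)
open import Relation.Nullary using (¬_; yes; no)
open import Relation.Unary using (Pred; _⊆_; _∪_; ∅; ｛_｝; ∁)

module DeterministicSimulation
  {S C : Set} (_↦_ : Rel S 0ℓ) (Halted : S → Set)
  (_⟶_ : Rel C 0ℓ) (⟶-deterministic : Deterministic _≡_ _⟶_)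
  {final : C} (final-normal : IsNormalForm _⟶_ final)
  (_≈_ : S → C → Set)
  (halted-or-steps : ∀ s → Halted s ⊎ ∃ (s ↦_))
  (simulate : ∀ {s s′ c} → s ↦ s′ → s ≈ c → ∃ λ c′ → TransClosure _⟶_ c c′ × s′ ≈ c′)
  (finish : ∀ {s c} → Halted s → s ≈ c → TransClosure _⟶_ c final)
  where

  HaltsFrom : S → Set
  HaltsFrom s = ∃ λ s′ → Star _↦_ s s′ × Halted s′

  ⁺⇒* : ∀ {c c′} → TransClosure _⟶_ c c′ → Star _⟶_ c c′
  ⁺⇒* [ t ] = t ◅ ε
  ⁺⇒* (t ∷ ts) = t ◅ ⁺⇒* ts

  uncons : ∀ {c c′} → TransClosure _⟶_ c c′ → ∃ λ c₁ → c ⟶ c₁ × Star _⟶_ c₁ c′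
  uncons [ t ] = -, t , ε
  uncons (t ∷ ts) = -, t , ⁺⇒* ts

  halts⇒reaches-final : ∀ {s c} → s ≈ c → HaltsFrom s → Star _⟶_ c final
  halts⇒reaches-final s≈c (_ , ε , halted) = ⁺⇒* (finish halted s≈c)
  halts⇒reaches-final s≈c (_ , st ◅ run , halted) =
    let _ , c⟶⁺c′ , s′≈c′ = simulate st s≈c
    in ⁺⇒* c⟶⁺c′ ◅◅ halts⇒reaches-final s′≈c′ (_ , run , halted)

  ≈-reducible : ∀ {s c} → s ≈ c → ∃ (c ⟶_)
  ≈-reducible {s} s≈c with halted-or-steps s
  ... | inj₁ halted = let _ , t , _ = uncons (finish halted s≈c) in -, t
  ... | inj₂ (_ , st) with simulate st s≈c
  ...   | _ , c⟶⁺c′ , _ = let _ , t , _ = uncons c⟶⁺c′ in -, t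

  -- Induction on the run a ⟶* final.  By determinism every run from a to the
  -- simulating term c is a prefix of it, and each simulated machine step uses
  -- up at least one of its reductions.
  reaches-final⇒halts : ∀ {a c s} → Star _⟶_ a final → Star _⟶_ a c → s ≈ c → HaltsFrom s
  reaches-final⇒halts ε ε s≈final = ⊥-elim (final-normal (≈-reducible s≈final))
  reaches-final⇒halts ε (t ◅ _) _ = ⊥-elim (final-normal (-, t))
  reaches-final⇒halts (t ◅ run) (t′ ◅ path) s≈c
    rewrite ⟶-deterministic t t′ = reaches-final⇒halts run path s≈c
  reaches-final⇒halts {s = s} (t ◅ run) ε s≈a with halted-or-steps s
  ... | inj₁ halted = s , ε , halted
  ... | inj₂ (_ , st) with simulate st s≈a
  ...   | _ , c⟶⁺c′ , s′≈c′ with uncons c⟶⁺c′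
  ...     | _ , t′ , path rewrite ⟶-deterministic t t′ =
    let s″ , steps , halted = reaches-final⇒halts run path s′≈c′
    in s″ , st ◅ steps , halted

  halts⇔reaches-final : ∀ {a s c} → Star _⟶_ a c → s ≈ c → HaltsFrom s ⇔ Star _⟶_ a final
  halts⇔reaches-final a⟶*c s≈c =
    mk⇔ (λ halts → a⟶*c ◅◅ halts⇒reaches-final s≈c halts)
        (λ run → reaches-final⇒halts run a⟶*c s≈c)

plug-op-irreducible : ∀ E {o v c} → ¬ (plug E (op o v) ⟶ c)
plug-op-irreducible hole ()
plug-op-irreducible (letE _ hole _) (letS ())
plug-op-irreducible (letE _ (letE y E c) _) (letS t) = plug-op-irreducible (letE y E c) t

ret≢plug-op : ∀ E {o v w} → ret w ≢ plug E (op o v)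
ret≢plug-op hole ()
ret≢plug-op (letE _ _ _) ()

let'-injective : ∀ {x y a b c d} → let' x a c ≡ let' y b d → x ≡ y × a ≡ b × c ≡ d
let'-injective refl = refl , refl , refl

plug-op-injective : ∀ E E′ {o o′ v v′} → plug E (op o v) ≡ plug E′ (op o′ v′) →
                    E ≡ E′ × o ≡ o′ × v ≡ v′
plug-op-injective hole hole refl = refl , refl , refl
plug-op-injective hole (letE _ _ _) ()
plug-op-injective (letE _ _ _) hole ()
plug-op-injective (letE _ E _) (letE _ E′ _) eq
  with refl , eq′ , refl ← let'-injective eq
  with refl , refl , refl ← plug-op-injective E E′ eq′ = refl , refl , refl

mutual
  ⟶-deterministic : Deterministic _≡_ _⟶_
  ⟶-deterministic (letS t) (letS t′) = cong (λ c → let' _ c _) (⟶-deterministic t t′)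
  ⟶-deterministic (letS ()) letR
  ⟶-deterministic letR (letS ())
  ⟶-deterministic letR letR = refl
  ⟶-deterministic appλ appλ = refl
  ⟶-deterministic appRec appRec = refl
  ⟶-deterministic ifT ifT = refl
  ⟶-deterministic ifF ifF = refl
  ⟶-deterministic t@(hS _) t′ = handle-deterministic t t′ refl
  ⟶-deterministic t@hR t′ = handle-deterministic t t′ refl
  ⟶-deterministic t@(hOp _) t′ = handle-deterministic t t′ refl

  -- The handled computations are separate indices because unifying ret w with
  -- plug E (op o v) gets stuck; they are compared afterwards.
  handle-deterministic : ∀ {h c c′ b b′} → handle h c ⟶ b → handle h c′ ⟶ b′ → c ≡ c′ → b ≡ b′
  handle-deterministic (hS t) (hS t′) refl = cong (handle _) (⟶-deterministic t t′)
  handle-deterministic (hS ()) hR refl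
  handle-deterministic (hS t) (hOp {E = E} _) refl = ⊥-elim (plug-op-irreducible E t)
  handle-deterministic hR (hS ()) refl
  handle-deterministic hR hR refl = refl
  handle-deterministic hR (hOp {E = E} _) eq = ⊥-elim (ret≢plug-op E eq)
  handle-deterministic (hOp {E = E} _) (hS t) refl = ⊥-elim (plug-op-irreducible E t)
  handle-deterministic (hOp {E = E} _) hR eq = ⊥-elim (ret≢plug-op E (sym eq))
  handle-deterministic (hOp {E = E} clause) (hOp {E = E′} clause′) eq
    with refl , refl , refl ← plug-op-injective E E′ eq
    with refl ← trans (sym clause) clause′ = refl

ret-normal : ∀ {v} → IsNormalForm _⟶_ (ret v)
ret-normal (_ , ())

_⟶⁺_ : Comp → Comp → Set
_⟶⁺_ = TransClosure _⟶_

_▸_ : ∀ {a b c} → a ⟶ b → b ≡ c → a ⟶ c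
t ▸ refl = t

if-≡ᵇ-refl : ∀ m {A : Set} {x y : A} → (if m ≡ᵇ m then x else y) ≡ x
if-≡ᵇ-refl m with m ≡ᵇ m | ≡⇒≡ᵇ m m refl
... | true | _ = refl

if-≡ᵇ-≢ : ∀ {m n} {A : Set} {x y : A} → m ≢ n → (if m ≡ᵇ n then x else y) ≡ y
if-≡ᵇ-≢ {m} {n} m≢n with m ≡ᵇ n | ≡ᵇ⇒≡ m n
... | true | sound = ⊥-elim (m≢n (sound tt))
... | false | _ = refl

fV-injective : ∀ {n} {l j : Fin n} → fV l ≡ fV j → l ≡ j
fV-injective eq = toℕ-injective (+-cancelˡ-≡ 7 _ _ eq)

-- The variables substituted by the steps of a simulated instruction; none of
-- them occurs free in a function value ⌜ t ⌝ below.
data LocalVar : Var → Set where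
  local-x₀ : LocalVar x₀
  local-x₁ : LocalVar x₁
  local-xV : LocalVar xV
  local-kV : LocalVar kV

local≢fV : ∀ {x n} {p : Fin n} → LocalVar x → x ≢ fV p
local≢fV local-x₀ ()
local≢fV local-x₁ ()
local≢fV local-xV ()
local≢fV local-kV ()

-- The value held by xᵢ when counter i is a: c_inc wraps xᵢ in λy.succ xᵢ, and
-- c_dec applies xᵢ to () to see whether it performs succ.
numeral : ℕ → Val
numeral zero = lam xV (ret unit)
numeral (suc a) = lam yV (op succOp (numeral a))

substV-numeral : ∀ x u a → substV x u (numeral a) ≡ numeral a
substV-numeral x u zero with x ≡ᵇ xV
... | true = refl
... | false = refl
substV-numeral x u (suc a) with x ≡ᵇ yV
... | true = refl
... | false = cong (λ v → lam yV (op succOp v)) (substV-numeral x u a)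

app2-cong : ∀ {f f′ a a′ b b′} → f ≡ f′ → a ≡ a′ → b ≡ b′ → app2 f a b ≡ app2 f′ a′ b′
app2-cong refl refl refl = refl

picks-map : ∀ {A B : Set} (f : A → B) xs →
            picks (map f xs) ≡ map (Product.map f (map f)) (picks xs)
picks-map f [] = refl
picks-map f (x ∷ xs) = cong ((f x , map f xs) ∷_) (begin
  map (λ (b , bs) → b , f x ∷ bs) (picks (map f xs))
    ≡⟨ cong (map _) (picks-map f xs) ⟩
  map (λ (b , bs) → b , f x ∷ bs) (map (Product.map f (map f)) (picks xs))
    ≡⟨ sym (List.map-∘ (picks xs)) ⟩
  map (λ (b , bs) → f b , f x ∷ map f bs) (picks xs)
    ≡⟨ List.map-∘ (picks xs) ⟩
  map (Product.map f (map f)) (map (λ (b , bs) → b , x ∷ bs) (picks xs)) ∎)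
  where open ≡-Reasoning

map-proj₁-picks : ∀ {A : Set} (xs : List A) → map proj₁ (picks xs) ≡ xs
map-proj₁-picks [] = refl
map-proj₁-picks (x ∷ xs) = cong (x ∷_) (trans (sym (List.map-∘ (picks xs))) (map-proj₁-picks xs))

picks-↭ : ∀ {A : Set} (xs : List A) → All (λ (y , ys) → xs ↭ y ∷ ys) (picks xs)
picks-↭ [] = []
picks-↭ (x ∷ xs) =
  ↭-refl ∷ All.gmap⁺ (λ xs↭y∷ys → ↭-trans (↭-prep x xs↭y∷ys) (↭-swap x _ ↭-refl)) (picks-↭ xs)

allFinL≡allFin : ∀ n → allFinL n ≡ allFin n
allFinL≡allFin zero = refl
allFinL≡allFin (suc n) =
  cong (zero ∷_) (trans (cong (map suc) (allFinL≡allFin n)) (List.map-tabulate id suc))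

∈-allFinL : ∀ {n} (i : Fin n) → i ∈ allFinL n
∈-allFinL {n} i = subst (i ∈_) (sym (allFinL≡allFin n)) (∈-allFin i)

allFinL-unique : ∀ n → Unique (allFinL n)
allFinL-unique n = subst Unique (sym (allFinL≡allFin n)) (allFin⁺ n)

module Program {n : ℕ} (code : Fin (suc n) → Inst n) where

  open import Data.List.Membership.DecPropositional (_≟_ {suc n}) using (_∈?_)

  Label : Set
  Label = Fin (suc n)

  instantiate : Inst n → (Label → Val) → Val → Val → Comp
  instantiate iUnit env a₀ a₁ = ret unit
  instantiate (iInc zero j) env a₀ a₁ =
    let' x₀ (ret (lam yV (op succOp a₀))) (app2 (env j) (var x₀) a₁)
  instantiate (iInc (suc zero) j) env a₀ a₁ =
    let' x₁ (ret (lam yV (op succOp a₁))) (app2 (env j) a₀ (var x₁))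
  instantiate (iDec zero j m) env a₀ a₁ =
    handle (hd xV (app2 (env j) a₀ a₁) (cl succOp x₀ kV (app2 (env m) (var x₀) a₁) ∷ []))
           (app a₀ unit)
  instantiate (iDec (suc zero) j m) env a₀ a₁ =
    handle (hd xV (app2 (env j) a₀ a₁) (cl succOp x₁ kV (app2 (env m) a₀ (var x₁)) ∷ []))
           (app a₁ unit)

  ⟦⟧I≡instantiate : ∀ c → ⟦ c ⟧I ≡ instantiate c (λ j → var (fV j)) (var x₀) (var x₁)
  ⟦⟧I≡instantiate iUnit = refl
  ⟦⟧I≡instantiate (iInc zero j) = refl
  ⟦⟧I≡instantiate (iInc (suc zero) j) = refl
  ⟦⟧I≡instantiate (iDec zero j m) = refl
  ⟦⟧I≡instantiate (iDec (suc zero) j m) = refl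

  instantiate-cong : ∀ c {env env′} a₀ a₁ → (∀ j → env j ≡ env′ j) →
                     instantiate c env a₀ a₁ ≡ instantiate c env′ a₀ a₁
  instantiate-cong iUnit a₀ a₁ env≗env′ = refl
  instantiate-cong (iInc zero j) a₀ a₁ env≗env′ rewrite env≗env′ j = refl
  instantiate-cong (iInc (suc zero) j) a₀ a₁ env≗env′ rewrite env≗env′ j = refl
  instantiate-cong (iDec zero j m) a₀ a₁ env≗env′ rewrite env≗env′ j | env≗env′ m = refl
  instantiate-cong (iDec (suc zero) j m) a₀ a₁ env≗env′ rewrite env≗env′ j | env≗env′ m = refl

  substC-fV-instantiate : ∀ c (l : Label) u env →
    substC (fV l) u (instantiate c env (var x₀) (var x₁))
      ≡ instantiate c (λ j → substV (fV l) u (env j)) (var x₀) (var x₁)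
  substC-fV-instantiate iUnit l u env = refl
  substC-fV-instantiate (iInc zero j) l u env = refl
  substC-fV-instantiate (iInc (suc zero) j) l u env = refl
  substC-fV-instantiate (iDec zero j m) l u env = refl
  substC-fV-instantiate (iDec (suc zero) j m) l u env = refl

  substC-x₀-instantiate : ∀ c u env → (∀ j → substV x₀ u (env j) ≡ env j) →
    substC x₀ u (instantiate c env (var x₀) (var x₁)) ≡ instantiate c env u (var x₁)
  substC-x₀-instantiate iUnit u env fresh = refl
  substC-x₀-instantiate (iInc zero j) u env fresh = refl
  substC-x₀-instantiate (iInc (suc zero) j) u env fresh rewrite fresh j = refl
  substC-x₀-instantiate (iDec zero j m) u env fresh rewrite fresh j = refl
  substC-x₀-instantiate (iDec (suc zero) j m) u env fresh rewrite fresh j | fresh m = refl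

  substC-x₁-instantiate : ∀ c u a₀ env → (∀ j → substV x₁ u (env j) ≡ env j) →
    substV x₁ u a₀ ≡ a₀ →
    substC x₁ u (instantiate c env a₀ (var x₁)) ≡ instantiate c env a₀ u
  substC-x₁-instantiate iUnit u a₀ env fresh fresh₀ = refl
  substC-x₁-instantiate (iInc zero j) u a₀ env fresh fresh₀ rewrite fresh j | fresh₀ = refl
  substC-x₁-instantiate (iInc (suc zero) j) u a₀ env fresh fresh₀ = refl
  substC-x₁-instantiate (iDec zero j m) u a₀ env fresh fresh₀ rewrite fresh j | fresh m | fresh₀ = refl
  substC-x₁-instantiate (iDec (suc zero) j m) u a₀ env fresh fresh₀ rewrite fresh j | fresh₀ = refl

  lamBody : Label → (Label → Val) → Val
  lamBody p env = lam x₀ (ret (lam x₁ (instantiate (code p) env (var x₀) (var x₁))))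

  lamBody-cong : ∀ p {env env′} → (∀ j → env j ≡ env′ j) → lamBody p env ≡ lamBody p env′
  lamBody-cong p env≗env′ =
    cong (λ c → lam x₀ (ret (lam x₁ c))) (instantiate-cong (code p) (var x₀) (var x₁) env≗env′)

  substV-fV-lamBody : ∀ (l : Label) u p env →
                      substV (fV l) u (lamBody p env) ≡ lamBody p (λ j → substV (fV l) u (env j))
  substV-fV-lamBody l u p env =
    cong (λ c → lam x₀ (ret (lam x₁ c))) (substC-fV-instantiate (code p) l u env)

  substV-local-lamBody : ∀ {x} → LocalVar x → ∀ u p env → (∀ j → substV x u (env j) ≡ env j) →
                         substV x u (lamBody p env) ≡ lamBody p env
  substV-local-lamBody local-x₀ u p env fresh = refl
  substV-local-lamBody local-x₁ u p env fresh = refl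
  substV-local-lamBody local-xV u p env fresh with code p
  ... | iUnit = refl
  ... | iInc zero j rewrite fresh j = refl
  ... | iInc (suc zero) j rewrite fresh j = refl
  ... | iDec zero j m rewrite fresh m = refl
  ... | iDec (suc zero) j m rewrite fresh m = refl
  substV-local-lamBody local-kV u p env fresh with code p
  ... | iUnit = refl
  ... | iInc zero j rewrite fresh j = refl
  ... | iInc (suc zero) j rewrite fresh j = refl
  ... | iDec zero j m rewrite fresh j = refl
  ... | iDec (suc zero) j m rewrite fresh j = refl

  -- The values bound to the function names during evaluation, as trees:
  -- fvar is fₚ itself and frec p e is  rec fₚ = λx₀.λx₁.cₚ  with each fⱼ in cₚ
  -- replaced by e j.  Unfolding the mutual recursion and calling functions
  -- produce ever new such values, not only the top-level ones.
  data Fun : Label → Set where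
    fvar : ∀ {p} → Fun p
    frec : (p : Label) → ((j : Label) → Fun j) → Fun p

  ⌜_⌝ : ∀ {p} → Fun p → Val
  ⌜ fvar {p} ⌝ = var (fV p)
  ⌜ frec p e ⌝ = rec (fV p) (lamBody p (λ j → ⌜ e j ⌝))

  substF : (l : Label) → Fun l → ∀ {p} → Fun p → Fun p
  substF l u (fvar {p}) with p ≟ l
  ... | yes refl = u
  ... | no _ = fvar
  substF l u (frec p e) with l ≟ p
  ... | yes _ = frec p e
  ... | no _ = frec p (λ j → substF l u (e j))

  mutual
    substV-⌜⌝ : ∀ l (u : Fun l) {p} (t : Fun p) → substV (fV l) ⌜ u ⌝ ⌜ t ⌝ ≡ ⌜ substF l u t ⌝
    substV-⌜⌝ l u (fvar {p}) with p ≟ l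
    ... | yes refl = if-≡ᵇ-refl (fV p)
    ... | no p≢l = if-≡ᵇ-≢ (λ eq → p≢l (sym (fV-injective eq)))
    substV-⌜⌝ l u (frec p e) with l ≟ p
    ... | yes refl = if-≡ᵇ-refl (fV p)
    ... | no l≢p = trans (if-≡ᵇ-≢ (l≢p ∘ fV-injective)) (cong (rec (fV p)) (substV-lamBody l u p e))

    substV-lamBody : ∀ l (u : Fun l) p (e : (j : Label) → Fun j) →
      substV (fV l) ⌜ u ⌝ (lamBody p (λ j → ⌜ e j ⌝)) ≡ lamBody p (λ j → ⌜ substF l u (e j) ⌝)
    substV-lamBody l u p e =
      trans (substV-fV-lamBody l ⌜ u ⌝ p _) (lamBody-cong p (λ j → substV-⌜⌝ l u (e j)))

  substV-local-⌜⌝ : ∀ {x} → LocalVar x → ∀ u {p} (t : Fun p) → substV x u ⌜ t ⌝ ≡ ⌜ t ⌝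
  substV-local-⌜⌝ local u fvar = if-≡ᵇ-≢ (local≢fV local)
  substV-local-⌜⌝ local u (frec p e) =
    trans (if-≡ᵇ-≢ (local≢fV local))
          (cong (rec (fV p)) (substV-local-lamBody local u p _ (λ j → substV-local-⌜⌝ local u (e j))))

  ClosedIn : Pred Label 0ℓ → ∀ {p} → Fun p → Set
  ClosedIn S (fvar {p}) = S p
  ClosedIn S (frec p e) = ∀ j → ClosedIn (S ∪ ｛ p ｝) (e j)

  Closed : ∀ {p} → Fun p → Set
  Closed = ClosedIn ∅

  ClosedIn-mono : ∀ {S S′} → S ⊆ S′ → ∀ {p} (t : Fun p) → ClosedIn S t → ClosedIn S′ t
  ClosedIn-mono S⊆S′ fvar closed = S⊆S′ closed
  ClosedIn-mono S⊆S′ (frec p e) closed j = ClosedIn-mono (Sum.map S⊆S′ id) (e j) (closed j)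

  ClosedIn-substF : ∀ {S S′} l (u : Fun l) → S ⊆ ｛ l ｝ ∪ S′ → ClosedIn S′ u →
                    ∀ {p} (t : Fun p) → ClosedIn S t → ClosedIn S′ (substF l u t)
  ClosedIn-substF l u S⊆ closed-u (fvar {p}) closed with p ≟ l
  ... | yes refl = closed-u
  ... | no p≢l = Sum.[ (λ l≡p → ⊥-elim (p≢l (sym l≡p))) , id ] (S⊆ closed)
  ClosedIn-substF l u S⊆ closed-u (frec p e) closed with l ≟ p
  ... | yes refl = λ j → ClosedIn-mono Sum.[ Sum.swap ∘ S⊆ , inj₂ ] (e j) (closed j)
  ... | no _ = λ j → ClosedIn-substF l u Sum.[ Sum.map₂ inj₁ ∘ S⊆ , inj₂ ∘ inj₂ ]
                       (ClosedIn-mono inj₁ u closed-u) (e j) (closed j)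

  substV-⌜⌝-fresh : ∀ {S} l v → ¬ S l → ∀ {p} (t : Fun p) → ClosedIn S t →
                    substV (fV l) v ⌜ t ⌝ ≡ ⌜ t ⌝
  substV-⌜⌝-fresh {S} l v l∉S (fvar {p}) p∈S =
    if-≡ᵇ-≢ {fV l} {fV p} (λ eq → l∉S (subst S (sym (fV-injective eq)) p∈S))
  substV-⌜⌝-fresh l v l∉S (frec p e) closed with l ≟ p
  ... | yes refl = if-≡ᵇ-refl (fV p)
  ... | no l≢p =
    trans (if-≡ᵇ-≢ (l≢p ∘ fV-injective))
          (cong (rec (fV p))
                (trans (substV-fV-lamBody l v p _)
                       (lamBody-cong p (λ j → substV-⌜⌝-fresh l v Sum.[ l∉S , l≢p ∘ sym ] (e j) (closed j)))))

  Binding : Set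
  Binding = Σ Label Fun

  substsF : List Binding → ∀ {p} → Fun p → Fun p
  substsF [] t = t
  substsF ((l , u) ∷ σ) t = substsF σ (substF l u t)

  ClosedIn-substsF : ∀ {S} σ → All (λ (_ , u) → ClosedIn S u) σ →
                     ∀ {p} (t : Fun p) → ClosedIn (S ∪ (_∈ map proj₁ σ)) t → ClosedIn S (substsF σ t)
  ClosedIn-substsF [] [] t closed = ClosedIn-mono Sum.[ id , (λ ()) ] t closed
  ClosedIn-substsF ((l , u) ∷ σ) (closed-u ∷ closed-σ) t closed =
    ClosedIn-substsF σ closed-σ (substF l u t)
      (ClosedIn-substF l u Sum.[ inj₂ ∘ inj₁ , Sum.[ inj₁ ∘ sym , inj₂ ∘ inj₂ ] ∘ Any.toSum ]
        (ClosedIn-mono inj₁ u closed-u) t closed)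

  unfold : (p : Label) → ((j : Label) → Fun j) → (j : Label) → Fun j
  unfold p e j = substF p (frec p e) (e j)

  unfold-closed : ∀ p e → Closed (frec p e) → ∀ j → Closed (unfold p e j)
  unfold-closed p e closed j =
    ClosedIn-substF p (frec p e) Sum.[ (λ ()) , inj₁ ] closed (e j) (closed j)

  Main : Comp → Comp
  Main c = let' zV c (ret vtrue)

  Calling : (p : Label) → ℕ × ℕ → Fun p → Comp
  Calling p (a , b) t = Main (app2 ⌜ t ⌝ (numeral a) (numeral b))

  Executing : Inst n → ((j : Label) → Fun j) → ℕ × ℕ → Comp
  Executing c env (a , b) = Main (instantiate c (λ j → ⌜ env j ⌝) (numeral a) (numeral b))

  apply-lamBody : ∀ p (env : (j : Label) → Fun j) a b →
    Main (app2 (lamBody p (λ j → ⌜ env j ⌝)) (numeral a) (numeral b)) ⟶⁺ Executing (code p) env (a , b)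
  apply-lamBody p env a b = letS (letS appλ) ∷ letS letR ∷ [ letS appλ ▸ cong Main bind-arguments ]
    where
      open ≡-Reasoning
      c : Inst n
      c = code p
      ⌜env⌝ : Label → Val
      ⌜env⌝ j = ⌜ env j ⌝
      bind-arguments :
        substC x₁ (substV wV _ (numeral b)) (substC x₀ (numeral a) (instantiate c ⌜env⌝ (var x₀) (var x₁)))
          ≡ instantiate c ⌜env⌝ (numeral a) (numeral b)
      bind-arguments = begin
        _ ≡⟨ cong (λ v → substC x₁ v _) (substV-numeral wV _ b) ⟩
        substC x₁ (numeral b) (substC x₀ (numeral a) (instantiate c ⌜env⌝ (var x₀) (var x₁)))
          ≡⟨ cong (substC x₁ (numeral b))
                  (substC-x₀-instantiate c (numeral a) ⌜env⌝ (λ j → substV-local-⌜⌝ local-x₀ _ (env j))) ⟩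
        substC x₁ (numeral b) (instantiate c ⌜env⌝ (numeral a) (var x₁))
          ≡⟨ substC-x₁-instantiate c (numeral b) (numeral a) ⌜env⌝
               (λ j → substV-local-⌜⌝ local-x₁ _ (env j)) (substV-numeral x₁ _ a) ⟩
        instantiate c ⌜env⌝ (numeral a) (numeral b) ∎

  call-⟶⁺ : ∀ p e ab → Calling p ab (frec p e) ⟶⁺ Executing (code p) (unfold p e) ab
  call-⟶⁺ p e (a , b) =
    letS (letS appRec) ▸ cong (λ f → Main (app2 f (numeral a) (numeral b))) (substV-lamBody p (frec p e) p e)
      ∷ apply-lamBody p (unfold p e) a b

  substC-app2-⌜⌝ : ∀ {x} → LocalVar x → ∀ u {p} (t : Fun p) a b {a′ b′} →
                   substV x u a ≡ a′ → substV x u b ≡ b′ →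
                   substC x u (app2 ⌜ t ⌝ a b) ≡ app2 ⌜ t ⌝ a′ b′
  substC-app2-⌜⌝ local u t a b refl refl rewrite substV-local-⌜⌝ local u t with local
  ... | local-x₀ = refl
  ... | local-x₁ = refl
  ... | local-xV = refl
  ... | local-kV = refl

  halt-⟶ : ∀ env ab → Executing iUnit env ab ⟶ ret vtrue
  halt-⟶ env ab = letR

  inc-⟶ : ∀ i j env a b →
          Executing (iInc i j) env (a , b) ⟶ Calling j (setC i (suc (getC i a b)) a b) (env j)
  inc-⟶ zero j env a b =
    letS letR ▸ cong Main (substC-app2-⌜⌝ local-x₀ _ (env j) (var x₀) (numeral b) refl (substV-numeral x₀ _ b))
  inc-⟶ (suc zero) j env a b =
    letS letR ▸ cong Main (substC-app2-⌜⌝ local-x₁ _ (env j) (numeral a) (var x₁) (substV-numeral x₁ _ a) refl)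

  dec-zero-⟶⁺ : ∀ i j m env a b → getC i a b ≡ 0 →
                Executing (iDec i j m) env (a , b) ⟶⁺ Calling j (a , b) (env j)
  dec-zero-⟶⁺ zero j m env .0 b refl =
    letS (hS appλ) ∷ [ letS hR ▸ cong Main (substC-app2-⌜⌝ local-xV unit (env j) (numeral 0) (numeral b)
                                             (substV-numeral xV unit 0) (substV-numeral xV unit b)) ]
  dec-zero-⟶⁺ (suc zero) j m env a .0 refl =
    letS (hS appλ) ∷ [ letS hR ▸ cong Main (substC-app2-⌜⌝ local-xV unit (env j) (numeral a) (numeral 0)
                                             (substV-numeral xV unit a) (substV-numeral xV unit 0)) ]

  -- The handler's succ clause receives the predecessor numeral as x_i and
  -- continues with f_m; the continuation bound to kV is discarded.
  dec-suc-⟶⁺ : ∀ i j m env a b {k} → getC i a b ≡ suc k →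
               Executing (iDec i j m) env (a , b) ⟶⁺ Calling m (setC i k a b) (env m)
  dec-suc-⟶⁺ zero j m env .(suc k) b {k} refl =
    letS (hS appλ) ∷ [ letS (hOp {E = hole} refl) ▸ cong Main
      (trans (cong (substC kV _) (substC-app2-⌜⌝ local-x₀ _ (env m) (var x₀) (numeral b)
                                    (substV-numeral yV _ k) (substV-numeral x₀ _ b)))
             (substC-app2-⌜⌝ local-kV _ (env m) (numeral k) (numeral b)
               (substV-numeral kV _ k) (substV-numeral kV _ b))) ]
  dec-suc-⟶⁺ (suc zero) j m env a .(suc k) {k} refl =
    letS (hS appλ) ∷ [ letS (hOp {E = hole} refl) ▸ cong Main
      (trans (cong (substC kV _) (substC-app2-⌜⌝ local-x₁ _ (env m) (numeral a) (var x₁)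
                                    (substV-numeral x₁ _ a) (substV-numeral yV _ k)))
             (substC-app2-⌜⌝ local-kV _ (env m) (numeral a) (numeral k)
               (substV-numeral kV _ a) (substV-numeral kV _ k))) ]

  ⌜_⌝ᵇ : Binding → Var × Val
  ⌜ l , u ⌝ᵇ = fV l , ⌜ u ⌝

  substsV-lamBody : ∀ σ p (e : (j : Label) → Fun j) →
    substsV (map ⌜_⌝ᵇ σ) (lamBody p (λ j → ⌜ e j ⌝)) ≡ lamBody p (λ j → ⌜ substsF σ (e j) ⌝)
  substsV-lamBody [] p e = refl
  substsV-lamBody ((l , u) ∷ σ) p e =
    trans (cong (substsV (map ⌜_⌝ᵇ σ)) (substV-lamBody l u p e)) (substsV-lamBody σ p (λ j → substF l u (e j)))

  definition : Label → Var × Val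
  definition j = fV j , lam x₀ (ret (lam x₁ ⟦ code j ⟧I))

  definition≡lamBody : ∀ p → proj₂ (definition p) ≡ lamBody p (λ j → ⌜ fvar {j} ⌝)
  definition≡lamBody p = cong (λ c → lam x₀ (ret (lam x₁ c))) (⟦⟧I≡instantiate (code p))

  mutual
    mrecTree : ℕ → List Label → (j : Label) → Fun j
    mrecTree zero L j = fvar
    mrecTree (suc k) L j = substsF (map (recBinding k) (picks L)) fvar

    recBinding : ℕ → Label × List Label → Binding
    recBinding k (l , rest) = l , frec l (mrecTree k rest)

  mrecValN≡lamBody : ∀ k L p →
    mrecValN k (map definition L) (proj₂ (definition p)) ≡ lamBody p (λ j → ⌜ mrecTree k L j ⌝)
  mrecValN≡lamBody zero L p = definition≡lamBody p
  mrecValN≡lamBody (suc k) L p =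
    trans (cong₂ substsV bindings (definition≡lamBody p))
          (substsV-lamBody (map (recBinding k) (picks L)) p (λ _ → fvar))
    where
      open ≡-Reasoning
      bindings = begin
        map _ (picks (map definition L))
          ≡⟨ cong (map _) (picks-map definition L) ⟩
        map _ (map (Product.map definition (map definition)) (picks L))
          ≡⟨ sym (List.map-∘ (picks L)) ⟩
        map (λ (l , r) → fV l , rec (fV l) (mrecValN k (map definition r) (proj₂ (definition l)))) (picks L)
          ≡⟨ List.map-cong (λ (l , r) → cong (λ v → fV l , rec (fV l) v) (mrecValN≡lamBody k r l)) (picks L) ⟩
        map (λ (l , r) → fV l , ⌜ frec l (mrecTree k r) ⌝) (picks L)
          ≡⟨ List.map-∘ (picks L) ⟩
        map ⌜_⌝ᵇ (map (recBinding k) (picks L)) ∎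

  mutual
    mrecTree-closed : ∀ k L → length L ≡ k → ∀ i → ClosedIn (∁ (_∈ L)) (mrecTree k L i)
    mrecTree-closed zero [] _ i = λ ()
    mrecTree-closed (suc k) L |L|≡1+k i =
      ClosedIn-substsF (map (recBinding k) (picks L))
        (All.gmap⁺ (λ L↭l∷r → recBinding-closed L↭l∷r
                                (suc-injective (trans (sym (↭-length L↭l∷r)) |L|≡1+k)))
                   (picks-↭ L))
        fvar free-or-bound
      where
        free-or-bound : ¬ i ∈ L ⊎ i ∈ map proj₁ (map (recBinding k) (picks L))
        free-or-bound with i ∈? L
        ... | no i∉L = inj₁ i∉L
        ... | yes i∈L = inj₂ (subst (i ∈_) (sym (trans (sym (List.map-∘ (picks L))) (map-proj₁-picks L))) i∈L)

    recBinding-closed : ∀ {k L l r} → L ↭ l ∷ r → length r ≡ k →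
                        ClosedIn (∁ (_∈ L)) (frec l (mrecTree k r))
    recBinding-closed {k} {L} {l} {r} L↭l∷r |r|≡k j =
      ClosedIn-mono outside (mrecTree k r j) (mrecTree-closed k r |r|≡k j)
      where
        outside : ∁ (_∈ r) ⊆ ∁ (_∈ L) ∪ ｛ l ｝
        outside {x} x∉r with x ∈? L
        ... | no x∉L = inj₁ x∉L
        ... | yes x∈L with ∈-resp-↭ L↭l∷r x∈L
        ...   | here x≡l = inj₂ (sym x≡l)
        ...   | there x∈r = ⊥-elim (x∉r x∈r)

  letChain : List Binding → Comp → Comp
  letChain [] c = c
  letChain ((l , u) ∷ σ) c = let' (fV l) (ret ⌜ u ⌝) (letChain σ c)

  topBinding : Label × List Label → Binding
  topBinding (l , rest) = recBinding (length rest) (l , rest)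

  labels : List Label
  labels = allFinL (suc n)

  mmProgram≡letChain : mmProgram n code ≡ letChain (map topBinding (picks labels)) (Calling zero (0 , 0) fvar)
  mmProgram≡letChain =
    trans (cong (foldr bindRec start) (picks-map definition labels)) (bindRecs≡letChain (picks labels))
    where
      start : Comp
      start = Calling zero (0 , 0) fvar
      bindRec : (Var × Val) × List (Var × Val) → Comp → Comp
      bindRec ((f , vf) , rest) c = let' f (ret (rec f (mrecVal rest vf))) c
      bindRecs≡letChain : ∀ ps → foldr bindRec start (map (Product.map definition (map definition)) ps)
                                 ≡ letChain (map topBinding ps) start
      bindRecs≡letChain [] = refl
      bindRecs≡letChain ((l , r) ∷ ps) =
        cong₂ (λ v c → let' (fV l) (ret (rec (fV l) v)) c)
              (trans (cong (λ k → mrecValN k (map definition r) (proj₂ (definition l))) (List.length-map definition r))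
                     (mrecValN≡lamBody (length r) r l))
              (bindRecs≡letChain ps)

  substC-letChain : ∀ l (u : Fun l) σ → ¬ l ∈ map proj₁ σ → All (λ (_ , t) → Closed t) σ →
                    ∀ {p} ab (t : Fun p) →
                    substC (fV l) ⌜ u ⌝ (letChain σ (Calling p ab t)) ≡ letChain σ (Calling p ab (substF l u t))
  substC-letChain l u [] l∉σ [] (a , b) t =
    cong Main (app2-cong (substV-⌜⌝ l u t) (substV-numeral _ _ a) (substV-numeral _ _ b))
  substC-letChain l u ((j , t′) ∷ σ) l∉σ (closed-t′ ∷ closed-σ) ab t =
    cong₂ (λ v c → let' (fV j) (ret v) c) (substV-⌜⌝-fresh l ⌜ u ⌝ (λ ()) t′ closed-t′)
          (trans (if-≡ᵇ-≢ (λ eq → l∉σ (here (fV-injective eq))))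
                 (substC-letChain l u σ (l∉σ ∘ there) closed-σ ab t))

  letChain-⟶* : ∀ σ → Unique (map proj₁ σ) → All (λ (_ , t) → Closed t) σ →
                ∀ {p} ab (t : Fun p) → letChain σ (Calling p ab t) ⟶* Calling p ab (substsF σ t)
  letChain-⟶* [] [] [] ab t = ε
  letChain-⟶* ((l , u) ∷ σ) (l∉σ ∷ unique) (_ ∷ closed-σ) ab t =
    (letR ▸ substC-letChain l u σ (All¬⇒¬Any l∉σ) closed-σ ab t)
      ◅ letChain-⟶* σ unique closed-σ ab (substF l u t)

  mmProgram-⟶*-Calling : ∃ λ t → Closed t × mmProgram n code ⟶* Calling zero (0 , 0) t
  mmProgram-⟶*-Calling =
    substsF σ fvar ,
    ClosedIn-substsF σ closed-σ fvar (inj₂ (subst (zero ∈_) (sym bound-labels) (∈-allFinL zero))) ,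
    subst (_⟶* Calling zero (0 , 0) (substsF σ fvar)) (sym mmProgram≡letChain)
      (letChain-⟶* σ (subst Unique (sym bound-labels) (allFinL-unique (suc n))) closed-σ (0 , 0) fvar)
    where
      σ : List Binding
      σ = map topBinding (picks labels)
      bound-labels : map proj₁ σ ≡ labels
      bound-labels = trans (sym (List.map-∘ (picks labels))) (map-proj₁-picks labels)
      top-closed : ∀ {(l , r) : Label × List Label} → labels ↭ l ∷ r → Closed (proj₂ (topBinding (l , r)))
      top-closed {l , r} labels↭l∷r =
        ClosedIn-mono (λ i∉labels → i∉labels (∈-allFinL _)) (proj₂ (topBinding (l , r)))
          (recBinding-closed labels↭l∷r refl)
      closed-σ : All (λ (_ , t) → Closed t) σ
      closed-σ = All.gmap⁺ top-closed (picks-↭ labels)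

nth-≥length : ∀ (M : MinskyMachine) {q} → length M ≤ q → nth M q ≡ nothing
nth-≥length [] _ = refl
nth-≥length (_ ∷ M) (s≤s |M|≤q) = nth-≥length M |M|≤q

halted-or-steps : ∀ M cfg → nth M (proj₁ cfg) ≡ nothing ⊎ ∃ (MStep M cfg)
halted-or-steps M (q , a , b) with nth M q in instr
... | nothing = inj₁ refl
... | just (inc i j) = inj₂ (-, sInc instr)
... | just (dec i j m) with getC i a b in counter
...   | zero = inj₂ (-, sDecZ instr counter)
...   | suc k = inj₂ (-, sDecS instr counter)

module Simulation (M : MinskyMachine) where

  N : ℕ
  N = length M

  -- Every jump target q ≥ N halts the machine; all of them go to the extra
  -- label N, whose body is ().
  label : ℕ → Fin (suc N)
  label q with q <? N
  ... | yes q<N = fromℕ< (m<n⇒m<1+n q<N)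
  ... | no _ = fromℕ N

  nth-label : ∀ q → nth M (toℕ (label q)) ≡ nth M q
  nth-label q with q <? N
  ... | yes q<N = cong (nth M) (toℕ-fromℕ< _)
  ... | no q≮N = trans (cong (nth M) (toℕ-fromℕ N))
                       (trans (nth-≥length M ≤-refl) (sym (nth-≥length M (≮⇒≥ q≮N))))

  compile : Maybe MInstr → Inst N
  compile nothing = iUnit
  compile (just (inc i j)) = iInc i (label j)
  compile (just (dec i j m)) = iDec i (label j) (label m)

  code : Fin (suc N) → Inst N
  code p = compile (nth M (toℕ p))

  open Program code

  data _≈_ : Config → Comp → Set where
    calling : ∀ {q ab p} {t : Fun p} → Closed t → nth M (toℕ p) ≡ nth M q → (q , ab) ≈ Calling p ab t

  enter : ∀ {p} {t : Fun p} {ins} ab → Closed t → nth M (toℕ p) ≡ ins →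
          ∃ λ env → (∀ j → Closed (env j)) × Calling p ab t ⟶⁺ Executing (compile ins) env ab
  enter {t = frec p e} ab closed refl = unfold p e , unfold-closed p e closed , call-⟶⁺ p e ab

  simulate : ∀ {cfg cfg′ c} → MStep M cfg cfg′ → cfg ≈ c → ∃ λ c′ → c ⟶⁺ c′ × cfg′ ≈ c′
  simulate (sInc {a = a} {b} {i} {j} instr) (calling closed p∼q) =
    let env , closed-env , entered = enter _ closed (trans p∼q instr)
    in -, entered ∷ʳ inc-⟶ i (label j) env a b , calling (closed-env _) (nth-label j)
  simulate (sDecZ {a = a} {b} {i} {j} {m} instr is-zero) (calling closed p∼q) =
    let env , closed-env , entered = enter _ closed (trans p∼q instr)
    in -, entered ++ dec-zero-⟶⁺ i (label j) (label m) env a b is-zero , calling (closed-env _) (nth-label j)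
  simulate (sDecS {a = a} {b} {i} {j} {m} instr nonzero) (calling closed p∼q) =
    let env , closed-env , entered = enter _ closed (trans p∼q instr)
    in -, entered ++ dec-suc-⟶⁺ i (label j) (label m) env a b nonzero , calling (closed-env _) (nth-label m)

  finish : ∀ {cfg c} → nth M (proj₁ cfg) ≡ nothing → cfg ≈ c → c ⟶⁺ ret vtrue
  finish halted (calling {ab = ab} closed p∼q) =
    let env , _ , entered = enter ab closed (trans p∼q halted) in entered ∷ʳ halt-⟶ env ab

  open DeterministicSimulation (MStep M) (λ cfg → nth M (proj₁ cfg) ≡ nothing)
         _⟶_ ⟶-deterministic ret-normal _≈_ (halted-or-steps M) simulate finish

  halts⇔mmTrue : Halts M ⇔ MMTrue (N , code)
  halts⇔mmTrue =
    let _ , closed , start = mmProgram-⟶*-Calling in halts⇔reaches-final start (calling closed refl)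

theorem7 : Σ (MinskyMachine → MMInstance) (λ red →
             (M : MinskyMachine) → Halts M ⇔ MMTrue (red M))
theorem7 = (λ M → length M , Simulation.code M) , Simulation.halts⇔mmTrue
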